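{- For every positive integer $t$, the number of distinct $t$-representative functions is at most $2^{2^t-1}$.
   Context: Let $B=\{v_1,\dots,v_t\}$ and let $\mathbb{N}$ include $0$. A function $f\colon 2^B\to\mathbb{N}$ is a $t$-representative function if (1) $f(\emptyset)=0$; (2) $f(S')\le f(S)$ whenever $S'\subseteq S\subseteq B$; (3) for every nonempty $S\subseteq B$, $f(S)\le 1+\min_{v\in S}f(S\setminus\{v\})$. Two such functions are distinct if they differ on some input. -}

module Defs where

open import Data.Nat using (ℕ; zero; suc; _≤_; _+_)
open import Data.Fin using (Fin)
open import Data.Fin.Subset using (Subset; ⊥; _⊆_; _∈_; _-_; Nonempty)
open import Data.Product using (_×_; ∃)
open import Relation.Binary.PropositionalEquality using (_≡_; _≢_)

-- B = {v_1,...,v_t} is modelled as Fin t; subsets of B as Subset t.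
-- A t-representative function f : 2^B → ℕ.
IsRepresentative : (t : ℕ) → (Subset t → ℕ) → Set
IsRepresentative t f =
  (f ⊥ ≡ 0)
  × (∀ (S′ S : Subset t) → S′ ⊆ S → f S′ ≤ f S)
  -- f(S) ≤ 1 + min_{v∈S} f(S∖{v})  for nonempty S, i.e. for every v ∈ S
  × (∀ (S : Subset t) → Nonempty S → ∀ (v : Fin t) → v ∈ S → f S ≤ suc (f (S - v)))

Distinct : {t : ℕ} → (Subset t → ℕ) → (Subset t → ℕ) → Set
Distinct f g = ∃ λ S → f S ≢ g S

-- For v ∈ S, monotonicity and condition (3) pin f S to {f (S - v), f (S - v) + 1}.
-- So, once a removable point v_S is fixed for every nonempty S, a representative f is
-- determined, by induction on S, by the bits [f S = f (S - v_S)] for the 2^t - 1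
-- nonempty S; distinct representatives have distinct bit vectors.
module Submission where

open import Defs
open import Data.Nat using (ℕ; _≤_; _^_; _∸_)
open import Data.Fin.Subset using (Subset)
open import Data.List using (List; length)
open import Data.List.Relation.Unary.All using (All)
open import Data.List.Relation.Unary.AllPairs using (AllPairs)

open import Data.Bool.Base using (Bool; false)
open import Data.Fin.Base using (Fin; zero; suc; punchIn; punchOut; funToFin; finToFun)
import Data.Fin.Base as Fin
open import Data.Fin.Properties
  using (2↔Bool; finToFun-funToFin; punchIn-punchOut; pigeonhole)
open import Data.Fin.Subset using (⊥; _-_; _∈_; _⊂_; Nonempty)
open import Data.Fin.Subset.Induction using (⊂-wellFounded)
open import Data.Fin.Subset.Properties
  using (nonempty?; Empty-unique; x∈p⇒p-x⊂p; ∉⊥)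
open import Data.List using (lookup; _∷_)
open import Data.List.Membership.Propositional.Properties using (∈-lookup)
open import Data.List.Relation.Unary.AllPairs using (_∷_)
import Data.List.Relation.Unary.All as All
open import Data.Nat using (suc; _<_; s≤s)
import Data.Nat as ℕ
open import Data.Nat.Properties using (≤-antisym; ≤∧≢⇒<; ≮⇒≥)
open import Data.Product using (∃; _×_; _,_; proj₁; proj₂)
open import Data.Vec using (Vec; tabulate) renaming (lookup to lookupᵛ)
open import Data.Vec.Properties using (lookup∘tabulate; tabulate∘lookup; tabulate-cong)
open import Function using (_∘_; Inverse)
open import Function.Definitions using (StrictlySurjective)
open import Induction.WellFounded using (Acc; acc)
open import Relation.Binary.PropositionalEquality
  using (_≡_; _≢_; refl; sym; trans; cong; ≢-sym; module ≡-Reasoning)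
open ≡-Reasoning
open import Relation.Nullary using (Dec; yes; no; does; ¬_; contradiction)

private
  variable
    m n t : ℕ

≡suc-if-≢ : ∀ {a x} → a ≤ x → x ≤ suc a → x ≢ a → x ≡ suc a
≡suc-if-≢ a≤x x≤1+a x≢a = ≤-antisym x≤1+a (≤∧≢⇒< a≤x (≢-sym x≢a))

within-suc-determined : ∀ {a b x y} → a ≤ x × x ≤ suc a → b ≤ y × y ≤ suc b → a ≡ b →
                        (x ≡ a → y ≡ b) → (y ≡ b → x ≡ a) → x ≡ y
within-suc-determined {a} {_} {x} (a≤x , x≤1+a) (a≤y , y≤1+a) refl x≡a⇒y≡a y≡a⇒x≡a with x ℕ.≟ a
... | yes x≡a = trans x≡a (sym (x≡a⇒y≡a x≡a))
... | no x≢a  = trans (≡suc-if-≢ a≤x x≤1+a x≢a) (sym (≡suc-if-≢ a≤y y≤1+a (x≢a ∘ y≡a⇒x≡a)))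

same-does⇒→ : ∀ {A B : Set} (a? : Dec A) (b? : Dec B) → does a? ≡ does b? → A → B
same-does⇒→ (yes _) (yes b) _  _ = b
same-does⇒→ (no ¬a) _       _  a = contradiction a ¬a
same-does⇒→ (yes _) (no _)  () _

nonempty⇒≢⊥ : ∀ {S : Subset t} → Nonempty S → S ≢ ⊥
nonempty⇒≢⊥ (_ , v∈⊥) refl = ∉⊥ v∈⊥

representative-step : ∀ {f : Subset t → ℕ} {S v} → IsRepresentative t f → v ∈ S →
                      f (S - v) ≤ f S × f S ≤ suc (f (S - v))
representative-step (_ , mono , step) v∈S =
  mono _ _ (proj₁ (x∈p⇒p-x⊂p v∈S)) , step _ (_ , v∈S) _ v∈S

flat : (Subset t → ℕ) → Subset t → Fin t → Bool
flat f S v = does (f S ℕ.≟ f (S - v))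

representatives-agree :
  ∀ {f g : Subset t → ℕ} → IsRepresentative t f → IsRepresentative t g →
  (∀ S → Nonempty S → ∃ λ v → v ∈ S × flat f S v ≡ flat g S v) →
  ∀ S → f S ≡ g S
representatives-agree {f = f} {g} rep-f rep-g same-flats S = agree (⊂-wellFounded S)
  where
  agree : ∀ {S} → Acc _⊂_ S → f S ≡ g S
  agree {S} (acc smaller) with nonempty? S
  ... | no S-empty rewrite Empty-unique S-empty = trans (proj₁ rep-f) (sym (proj₁ rep-g))
  ... | yes nonempty with v , v∈S , same-flat ← same-flats S nonempty =
    within-suc-determined (representative-step rep-f v∈S) (representative-step rep-g v∈S)
      (agree (smaller (x∈p⇒p-x⊂p v∈S)))
      (same-does⇒→ (_ ℕ.≟ _) (_ ℕ.≟ _) same-flat)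
      (same-does⇒→ (_ ℕ.≟ _) (_ ℕ.≟ _) (sym same-flat))

-- The point removed from S is the one picked by nonempty?; the value at ⊥ is irrelevant.
pivotFlat : (Subset t → ℕ) → Subset t → Bool
pivotFlat f S with nonempty? S
... | yes (v , _) = flat f S v
... | no _        = false

same-pivotFlat : ∀ {f g : Subset t → ℕ} S → Nonempty S → pivotFlat f S ≡ pivotFlat g S →
                 ∃ λ v → v ∈ S × flat f S v ≡ flat g S v
same-pivotFlat S nonempty same with nonempty? S
... | yes (v , v∈S) = v , v∈S , same
... | no S-empty    = contradiction nonempty S-empty

encode : Vec Bool n → Fin (2 ^ n)
encode xs = funToFin (Inverse.from 2↔Bool ∘ lookupᵛ xs)

decode : Fin (2 ^ n) → Vec Bool n
decode i = tabulate (Inverse.to 2↔Bool ∘ finToFun i)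

decode-encode : (xs : Vec Bool n) → decode (encode xs) ≡ xs
decode-encode xs = trans (tabulate-cong decode-bit) (tabulate∘lookup xs)
  where
  decode-bit : ∀ k → Inverse.to 2↔Bool (finToFun (encode xs) k) ≡ lookupᵛ xs k
  decode-bit k = trans (cong (Inverse.to 2↔Bool) (finToFun-funToFin _ k))
                       (Inverse.strictlyInverseˡ 2↔Bool (lookupᵛ xs k))

encode-injective : {xs ys : Vec Bool n} → encode xs ≡ encode ys → xs ≡ ys
encode-injective {xs = xs} {ys} eq =
  trans (sym (decode-encode xs)) (trans (cong decode eq) (decode-encode ys))

decode-surjective : StrictlySurjective _≡_ (decode {n})
decode-surjective xs = encode xs , decode-encode xs

punchIn-surjective-off : ∀ {A : Set} (e : Fin (suc m) → A) → StrictlySurjective _≡_ e →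
                         ∀ i x → x ≢ e i → ∃ λ k → e (punchIn i k) ≡ x
punchIn-surjective-off e surj i x x≢ei with j , ej≡x ← surj x = punchOut i≢j , eq
  where
  i≢j : i ≢ j
  i≢j refl = x≢ei (sym ej≡x)
  eq = trans (cong e (punchIn-punchOut i≢j)) ej≡x

AllPairs-lookup : ∀ {A : Set} {R : A → A → Set} {xs : List A} → AllPairs R xs →
                  ∀ {i j} → i Fin.< j → R (lookup xs i) (lookup xs j)
AllPairs-lookup {xs = _ ∷ xs} (Rx ∷ _) {zero} {suc j} _ = All.lookup Rx (∈-lookup {xs = xs} j)
AllPairs-lookup (_ ∷ Rxs) {suc i} {suc j} (s≤s i<j) = AllPairs-lookup Rxs i<j

-- e need only be onto; the bit at a preimage of ⊥ carries no information, hence n ∸ 1.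
length-representatives≤ : (e : Fin n → Subset t) → StrictlySurjective _≡_ e →
                          (fs : List (Subset t → ℕ)) →
                          All (IsRepresentative t) fs → AllPairs Distinct fs →
                          length fs ≤ 2 ^ (n ∸ 1)
length-representatives≤ {n = ℕ.zero} e surj _ _ _ with () ← surj ⊥
length-representatives≤ {n = suc m} {t} e surj fs reps distinct = ≮⇒≥ too-many
  where
  i⊥ : Fin (suc m)
  i⊥ = proj₁ (surj ⊥)

  profile : (Subset t → ℕ) → Vec Bool m
  profile f = tabulate (λ k → pivotFlat f (e (punchIn i⊥ k)))

  same-profile⇒same-flats :
    ∀ {f g} → profile f ≡ profile g →
    ∀ S → Nonempty S → ∃ λ v → v ∈ S × flat f S v ≡ flat g S v
  same-profile⇒same-flats {f} {g} same S nonempty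
    with k , refl ← punchIn-surjective-off e surj i⊥ S
                      (λ S≡ → nonempty⇒≢⊥ nonempty (trans S≡ (proj₂ (surj ⊥))))
    = same-pivotFlat _ nonempty (begin
        pivotFlat f (e (punchIn i⊥ k)) ≡⟨ lookup∘tabulate _ k ⟨
        lookupᵛ (profile f) k          ≡⟨ cong (λ bits → lookupᵛ bits k) same ⟩
        lookupᵛ (profile g) k          ≡⟨ lookup∘tabulate _ k ⟩
        pivotFlat g (e (punchIn i⊥ k)) ∎)

  too-many : ¬ 2 ^ m < length fs
  too-many 2^m<length
    with i , j , i<j , same-code ← pigeonhole 2^m<length (encode ∘ profile ∘ lookup fs)
    with S , differ ← AllPairs-lookup distinct i<j
    = differ (representatives-agree (All.lookup reps (∈-lookup i)) (All.lookup reps (∈-lookup j))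
                                    (same-profile⇒same-flats (encode-injective same-code)) S)

lemma15 : (t : ℕ) → 1 ≤ t → (fs : List (Subset t → ℕ)) →
    All (IsRepresentative t) fs → AllPairs Distinct fs →
    length fs ≤ 2 ^ (2 ^ t ∸ 1)
lemma15 t _ = length-representatives≤ decode decode-surjective
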